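{- Let $D\geq 0$ be an integer and let $P\in V_d$ be a palindromic polynomial of odd index $d$ with integer coefficients. Then for every integer $i\geq 0$, every coefficient of the polynomial $\Phi_D^i(P)$ (the $i$-fold iterate of $\Phi_D$ applied to $P$) is divisible by $2^i$.
   Context: A polynomial $P(x)=\sum_{j=0}^d p_jx^j$ with rational coefficients is palindromic of index $d$ if $p_j=p_{d-j}$ for all $0\le j\le d$; $V_d$ denotes the vector space of such polynomials. For an integer $D\geq 0$, the linear operator $\Phi_D: V_d\to V_{d+2D-2}$ is defined by $$(x-1)^2\,\Phi_D(P)(x)=(x^{d+2D}+1)P(1)-2x^DP(x);$$ the right-hand side is always divisible by $(x-1)^2$; explicitly $\Phi_D(x^i+x^{d-i})=2\frac{(1-x^{i+D})(1-x^{d+D-i})}{(1-x)^2}$ for $0\le i\le d$. Iterates are taken with the index updated each time ($\Phi_D^{k}(P)\in V_{d+k(2D-2)}$). -}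

module Defs where

open import Data.Nat using (ℕ; zero; suc; _≤_; _<_; _≤ᵇ_; _≡ᵇ_) renaming (_+_ to _+ℕ_; _*_ to _*ℕ_; _∸_ to _∸ℕ_)
open import Data.Integer using (ℤ; +_; _+_; _-_; _*_)
open import Data.Bool using (if_then_else_)
open import Data.Product using (_×_; ∃)
open import Relation.Binary.PropositionalEquality using (_≡_)

-- A polynomial with integer coefficients, given by its coefficient
-- sequence: Poly p means p j is the coefficient of x^j.
Poly : Set
Poly = ℕ → ℤ

sumBelow : ℕ → (ℕ → ℤ) → ℤ
sumBelow zero    f = + 0
sumBelow (suc n) f = sumBelow n f + f n

Palindromic : ℕ → Poly → Set
Palindromic d p = (∀ j → j ≤ d → p j ≡ p (d ∸ℕ j)) × (∀ j → d < j → p j ≡ + 0)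

OddNat : ℕ → Set
OddNat d = ∃ λ k → d ≡ suc (2 *ℕ k)

monomial : ℕ → ℤ → Poly
monomial m c n = if n ≡ᵇ m then c else + 0

addP : Poly → Poly → Poly
addP p q n = p n + q n

subP : Poly → Poly → Poly
subP p q n = p n - q n

scaleP : ℤ → Poly → Poly
scaleP c p n = c * p n

shiftP : ℕ → Poly → Poly
shiftP m p n = if m ≤ᵇ n then p (n ∸ℕ m) else + 0

-- evaluation at 1 of a polynomial of degree ≤ d
evalAt1 : ℕ → Poly → ℤ
evalAt1 d p = sumBelow (suc d) p

-- Division by (x-1)^2 = (1-x)^2, i.e. multiplication by the power series
-- 1/(1-x)^2 = Σ (k+1) x^k.  On polynomials divisible by (x-1)^2 (the only
-- case in which it is used) this is exact polynomial division.
divBySq : Poly → Poly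
divBySq r n = sumBelow (suc n) (λ k → + (suc n ∸ℕ k) * r k)

phiRHS : ℕ → ℕ → Poly → Poly
phiRHS D d p =
  subP (addP (monomial (d +ℕ 2 *ℕ D) (evalAt1 d p)) (monomial 0 (evalAt1 d p)))
       (scaleP (+ 2) (shiftP D p))

-- Φ_D : V_d → V_{d+2D-2},  (x-1)^2 Φ_D(P) = (x^{d+2D}+1)P(1) - 2x^D P(x)
Φ : ℕ → ℕ → Poly → Poly
Φ D d p = divBySq (phiRHS D d p)

ΦIter : ℕ → ℕ → ℕ → Poly → Poly
ΦIter D zero    d p = p
ΦIter D (suc i) d p = ΦIter D i (d +ℕ 2 *ℕ D ∸ℕ 2) (Φ D d p)

-- Since d is odd, a palindromic P of index d has no middle coefficient, so
-- P = Σ_{i ≤ (d-1)/2} p_i (x^i + x^(d-i)).  By linearity of Φ_D and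
--   Φ_D(x^i + x^(d-i)) = 2 (1 - x^(D+i)) (1 - x^(D+d-i)) / (1 - x)^2
-- we get Φ_D(P) = 2Q, where Q has integer coefficients and is again palindromic,
-- of the odd index d + 2D - 2; in the one case where that index would be
-- negative (d = 1, D = 0) the factor 1 - x^0 makes Q = 0.  Induction on i then
-- collects one factor 2 per application of Φ_D.

module Submission where

open import Defs
open import Data.Nat using (ℕ; zero; suc; _^_; _≤_; _<_; s≤s)
import Data.Nat as ℕ
import Data.Nat.Properties as ℕₚ
import Data.Nat.Tactic.RingSolver as ℕ-Solver
open import Data.Integer using (ℤ; +_; _+_; _-_; _*_; -_; _⊖_)
import Data.Integer.Properties as ℤₚ
open import Algebra.Properties.CommutativeSemigroup ℤₚ.+-commutativeSemigroup
  using () renaming (interchange to +-interchange)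
open import Algebra.Properties.CommutativeSemigroup ℤₚ.*-commutativeSemigroup
  using () renaming (x∙yz≈y∙xz to *-left-swap)
open import Data.Integer.Divisibility using (_∣_; *-monoʳ-∣)
open import Data.Nat.Divisibility using (1∣_)
open import Data.Integer.Tactic.RingSolver using (solve-∀)
open import Data.Bool using (true; false)
open import Data.Product using (Σ; _×_; _,_)
open import Data.Sum using (inj₁; inj₂)
open import Function using (_∘_)
open import Relation.Nullary using (Dec; yes; no; contradiction)
open import Relation.Nullary.Reflects using (ofʸ; ofⁿ)
open import Relation.Binary.PropositionalEquality

-- Finite sums, monomials and shifts

sumBelow-cong : ∀ m {f g : ℕ → ℤ} → (∀ k → k < m → f k ≡ g k) → sumBelow m f ≡ sumBelow m g
sumBelow-cong zero    f≡g = refl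
sumBelow-cong (suc m) f≡g =
  cong₂ _+_ (sumBelow-cong m (λ k k<m → f≡g k (ℕₚ.m<n⇒m<1+n k<m))) (f≡g m ℕₚ.≤-refl)

sumBelow-+ : ∀ m (f g : ℕ → ℤ) → sumBelow m (λ k → f k + g k) ≡ sumBelow m f + sumBelow m g
sumBelow-+ zero    f g = refl
sumBelow-+ (suc m) f g =
  trans (cong (_+ (f m + g m)) (sumBelow-+ m f g)) (+-interchange (sumBelow m f) (sumBelow m g) (f m) (g m))

sumBelow-* : ∀ m c (f : ℕ → ℤ) → sumBelow m (λ k → c * f k) ≡ c * sumBelow m f
sumBelow-* zero    c f = sym (ℤₚ.*-zeroʳ c)
sumBelow-* (suc m) c f =
  trans (cong (_+ c * f m) (sumBelow-* m c f)) (sym (ℤₚ.*-distribˡ-+ c (sumBelow m f) (f m)))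

sumBelow-zero : ∀ m {f : ℕ → ℤ} → (∀ k → k < m → f k ≡ + 0) → sumBelow m f ≡ + 0
sumBelow-zero m f≡0 = trans (sumBelow-cong m f≡0) (sumBelow-const0 m)
  where
  sumBelow-const0 : ∀ m → sumBelow m (λ _ → + 0) ≡ + 0
  sumBelow-const0 zero    = refl
  sumBelow-const0 (suc m) = cong (_+ + 0) (sumBelow-const0 m)

sumBelow-single : ∀ m t {f : ℕ → ℤ} → t < m → (∀ k → k < m → k ≢ t → f k ≡ + 0) →
                  sumBelow m f ≡ f t
sumBelow-single (suc m) t {f} t<1+m f≡0 with t ℕₚ.≟ m
... | yes refl = trans (cong (_+ f t) rest≡0) (ℤₚ.+-identityˡ (f t))
  where
  rest≡0 : sumBelow t f ≡ + 0
  rest≡0 = sumBelow-zero t (λ k k<t → f≡0 k (ℕₚ.m<n⇒m<1+n k<t) (ℕₚ.<⇒≢ k<t))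
... | no t≢m = trans (cong₂ _+_ rest≡ft (f≡0 m ℕₚ.≤-refl (t≢m ∘ sym))) (ℤₚ.+-identityʳ (f t))
  where
  rest≡ft : sumBelow m f ≡ f t
  rest≡ft = sumBelow-single m t (ℕₚ.≤∧≢⇒< (ℕₚ.≤-pred t<1+m) t≢m)
                                (λ k k<m → f≡0 k (ℕₚ.m<n⇒m<1+n k<m))

monomial-≡ : ∀ t c → monomial t c t ≡ c
monomial-≡ t c with t ℕ.≡ᵇ t | ℕₚ.≡⇒≡ᵇ t t refl
... | true | _ = refl

monomial-≢ : ∀ t c {n} → n ≢ t → monomial t c n ≡ + 0
monomial-≢ t c {n} n≢t with n ℕ.≡ᵇ t | ℕₚ.≡ᵇ⇒≡ n t
... | false | _    = refl
... | true  | n≡t = contradiction (n≡t _) n≢t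

monomial-+ : ∀ t a b → monomial t (a + b) ≗ addP (monomial t a) (monomial t b)
monomial-+ t a b n with n ℕ.≡ᵇ t
... | true  = refl
... | false = refl

monomial-* : ∀ t c a → monomial t (c * a) ≗ scaleP c (monomial t a)
monomial-* t c a n with n ℕ.≡ᵇ t
... | true  = refl
... | false = sym (ℤₚ.*-zeroʳ c)

sumBelow-monomial : ∀ m t c → t < m → sumBelow m (monomial t c) ≡ c
sumBelow-monomial m t c t<m =
  trans (sumBelow-single m t t<m (λ k _ → monomial-≢ t c)) (monomial-≡ t c)

shiftP-≤ : ∀ {m n} (p : Poly) → m ≤ n → shiftP m p n ≡ p (n ℕ.∸ m)
shiftP-≤ {m} {n} p m≤n with m ℕ.≤ᵇ n | ℕₚ.≤ᵇ-reflects-≤ m n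
... | true  | _       = refl
... | false | ofⁿ m≰n = contradiction m≤n m≰n

shiftP-< : ∀ {m n} (p : Poly) → n < m → shiftP m p n ≡ + 0
shiftP-< {m} {n} p n<m with m ℕ.≤ᵇ n | ℕₚ.≤ᵇ-reflects-≤ m n
... | false | _       = refl
... | true  | ofʸ m≤n = contradiction m≤n (ℕₚ.<⇒≱ n<m)

shiftP-monomial : ∀ m t c → shiftP m (monomial t c) ≗ monomial (m ℕ.+ t) c
shiftP-monomial m t c n with n ℕₚ.≟ m ℕ.+ t
... | yes refl = begin
  shiftP m (monomial t c) (m ℕ.+ t)  ≡⟨ shiftP-≤ (monomial t c) (ℕₚ.m≤m+n m t) ⟩
  monomial t c (m ℕ.+ t ℕ.∸ m)       ≡⟨ cong (monomial t c) (ℕₚ.m+n∸m≡n m t) ⟩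
  monomial t c t                     ≡⟨ monomial-≡ t c ⟩
  c                                  ≡⟨ monomial-≡ (m ℕ.+ t) c ⟨
  monomial (m ℕ.+ t) c (m ℕ.+ t)     ∎
  where open ≡-Reasoning
... | no n≢m+t = trans shifted≡0 (sym (monomial-≢ (m ℕ.+ t) c n≢m+t))
  where
  shifted≡0 : shiftP m (monomial t c) n ≡ + 0
  shifted≡0 with m ℕₚ.≤? n
  ... | yes m≤n = trans (shiftP-≤ (monomial t c) m≤n)
                        (monomial-≢ t c (λ n∸m≡t → n≢m+t (trans (sym (ℕₚ.m+[n∸m]≡n m≤n))
                                                                 (cong (m ℕ.+_) n∸m≡t))))
  ... | no m≰n  = shiftP-< (monomial t c) (ℕₚ.≰⇒> m≰n)

-- Linearity of Φ

record IsLinear (f : Poly → Poly) : Set where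
  field
    f-cong      : ∀ {p q} → p ≗ q → f p ≗ f q
    additive    : ∀ p q → f (addP p q) ≗ addP (f p) (f q)
    homogeneous : ∀ c p → f (scaleP c p) ≗ scaleP c (f p)

  subtractive : ∀ p q → f (subP p q) ≗ subP (f p) (f q)
  subtractive p q n = begin
    f (subP p q) n                      ≡⟨ f-cong (λ k → cong (_+_ (p k)) (sym (ℤₚ.-1*i≡-i (q k)))) n ⟩
    f (addP p (scaleP (- + 1) q)) n     ≡⟨ additive p (scaleP (- + 1) q) n ⟩
    f p n + f (scaleP (- + 1) q) n      ≡⟨ cong (_+_ (f p n)) (homogeneous (- + 1) q n) ⟩
    f p n + - + 1 * f q n               ≡⟨ cong (_+_ (f p n)) (ℤₚ.-1*i≡-i (f q n)) ⟩
    f p n - f q n                       ∎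
    where open ≡-Reasoning

  zero-preserving : ∀ {p} → p ≗ (λ _ → + 0) → f p ≗ (λ _ → + 0)
  zero-preserving {p} p≗0 n = begin
    f p n                        ≡⟨ f-cong (λ k → trans (p≗0 k) (sym (ℤₚ.*-zeroˡ (p k)))) n ⟩
    f (scaleP (+ 0) p) n         ≡⟨ homogeneous (+ 0) p n ⟩
    + 0 * f p n                  ≡⟨ ℤₚ.*-zeroˡ (f p n) ⟩
    + 0                          ∎
    where open ≡-Reasoning

  sumBelow-commute : ∀ m (G : ℕ → Poly) →
                     f (λ n → sumBelow m (λ i → G i n)) ≗ (λ n → sumBelow m (λ i → f (G i) n))
  sumBelow-commute zero    G = zero-preserving (λ _ → refl)
  sumBelow-commute (suc m) G n =
    trans (additive (λ n → sumBelow m (λ i → G i n)) (G m) n)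
          (cong (_+ f (G m) n) (sumBelow-commute m G n))

open IsLinear

∘-isLinear : ∀ {f g} → IsLinear f → IsLinear g → IsLinear (f ∘ g)
∘-isLinear {f} {g} F G = record
  { f-cong      = λ p≗q → f-cong F (f-cong G p≗q)
  ; additive    = λ p q n → trans (f-cong F (additive G p q) n) (additive F (g p) (g q) n)
  ; homogeneous = λ c p n → trans (f-cong F (homogeneous G c p) n) (homogeneous F c (g p) n)
  }

divBySq-isLinear : IsLinear divBySq
divBySq-isLinear = record
  { f-cong      = λ r≗s n → sumBelow-cong (suc n) (λ k _ → cong (+ (suc n ℕ.∸ k) *_) (r≗s k))
  ; additive    = λ r s n →
      trans (sumBelow-cong (suc n) (λ k _ → ℤₚ.*-distribˡ-+ (+ (suc n ℕ.∸ k)) (r k) (s k)))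
            (sumBelow-+ (suc n) (λ k → + (suc n ℕ.∸ k) * r k) (λ k → + (suc n ℕ.∸ k) * s k))
  ; homogeneous = λ c r n →
      trans (sumBelow-cong (suc n) (λ k _ → *-left-swap (+ (suc n ℕ.∸ k)) c (r k)))
            (sumBelow-* (suc n) c (λ k → + (suc n ℕ.∸ k) * r k))
  }

divBySq-monomial : ∀ t c n → divBySq (monomial t c) n ≡ c * + (suc n ℕ.∸ t)
divBySq-monomial t c n = by-cases (t ℕₚ.≤? n)
  where
  open ≡-Reasoning
  off-diagonal : ∀ {k} → k ≢ t → + (suc n ℕ.∸ k) * monomial t c k ≡ + 0
  off-diagonal {k} k≢t =
    trans (cong (+ (suc n ℕ.∸ k) *_) (monomial-≢ t c k≢t)) (ℤₚ.*-zeroʳ (+ (suc n ℕ.∸ k)))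

  by-cases : Dec (t ≤ n) → divBySq (monomial t c) n ≡ c * + (suc n ℕ.∸ t)
  by-cases (yes t≤n) = begin
    divBySq (monomial t c) n          ≡⟨ sumBelow-single (suc n) t (s≤s t≤n) (λ k _ → off-diagonal) ⟩
    + (suc n ℕ.∸ t) * monomial t c t  ≡⟨ cong (+ (suc n ℕ.∸ t) *_) (monomial-≡ t c) ⟩
    + (suc n ℕ.∸ t) * c               ≡⟨ ℤₚ.*-comm (+ (suc n ℕ.∸ t)) c ⟩
    c * + (suc n ℕ.∸ t)               ∎
  by-cases (no t≰n) = begin
    divBySq (monomial t c) n          ≡⟨ sumBelow-zero (suc n) (λ k k<1+n → off-diagonal (k≢t k<1+n)) ⟩
    + 0                               ≡⟨ ℤₚ.*-zeroʳ c ⟨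
    c * + 0                           ≡⟨ cong (λ m → c * + m) (ℕₚ.m≤n⇒m∸n≡0 (ℕₚ.≰⇒> t≰n)) ⟨
    c * + (suc n ℕ.∸ t)               ∎
    where
    k≢t : ∀ {k} → k < suc n → k ≢ t
    k≢t k<1+n refl = t≰n (ℕₚ.≤-pred k<1+n)

shiftP-isLinear : ∀ m → IsLinear (shiftP m)
shiftP-isLinear m = record { f-cong = shift-cong ; additive = shift-+ ; homogeneous = shift-* }
  where
  shift-cong : ∀ {p q} → p ≗ q → shiftP m p ≗ shiftP m q
  shift-cong p≗q n with m ℕ.≤ᵇ n
  ... | true  = p≗q (n ℕ.∸ m)
  ... | false = refl

  shift-+ : ∀ p q → shiftP m (addP p q) ≗ addP (shiftP m p) (shiftP m q)
  shift-+ p q n with m ℕ.≤ᵇ n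
  ... | true  = refl
  ... | false = refl

  shift-* : ∀ c p → shiftP m (scaleP c p) ≗ scaleP c (shiftP m p)
  shift-* c p n with m ℕ.≤ᵇ n
  ... | true  = refl
  ... | false = sym (ℤₚ.*-zeroʳ c)

phiRHS-isLinear : ∀ D d → IsLinear (phiRHS D d)
phiRHS-isLinear D d = record { f-cong = rhs-cong ; additive = rhs-+ ; homogeneous = rhs-* }
  where
  top : ℕ
  top = d ℕ.+ 2 ℕ.* D

  rhs : ℕ → ℤ → ℤ → ℤ
  rhs n e s = (monomial top e n + monomial 0 e n) - + 2 * s

  rhs-cong : ∀ {p q} → p ≗ q → phiRHS D d p ≗ phiRHS D d q
  rhs-cong p≗q n = cong₂ (rhs n) (sumBelow-cong (suc d) (λ k _ → p≗q k))
                                 (f-cong (shiftP-isLinear D) p≗q n)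

  rhs-+ : ∀ p q → phiRHS D d (addP p q) ≗ addP (phiRHS D d p) (phiRHS D d q)
  rhs-+ p q n = begin
    rhs n (evalAt1 d (addP p q)) (shiftP D (addP p q) n)
      ≡⟨ cong₂ (rhs n) (sumBelow-+ (suc d) p q) (additive (shiftP-isLinear D) p q n) ⟩
    rhs n (a + b) (s + t)
      ≡⟨ cong₂ (λ x y → (x + y) - + 2 * (s + t)) (monomial-+ top a b n) (monomial-+ 0 a b n) ⟩
    ((monomial top a n + monomial top b n) + (monomial 0 a n + monomial 0 b n)) - + 2 * (s + t)
      ≡⟨ interchange (monomial top a n) (monomial top b n) (monomial 0 a n) (monomial 0 b n) s t ⟩
    rhs n a s + rhs n b t
      ∎
    where
    open ≡-Reasoning
    a : ℤ
    a = evalAt1 d p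
    b : ℤ
    b = evalAt1 d q
    s : ℤ
    s = shiftP D p n
    t : ℤ
    t = shiftP D q n
    interchange : ∀ x y z w u v →
                  ((x + y) + (z + w)) - + 2 * (u + v) ≡ ((x + z) - + 2 * u) + ((y + w) - + 2 * v)
    interchange = solve-∀

  rhs-* : ∀ c p → phiRHS D d (scaleP c p) ≗ scaleP c (phiRHS D d p)
  rhs-* c p n = begin
    rhs n (evalAt1 d (scaleP c p)) (shiftP D (scaleP c p) n)
      ≡⟨ cong₂ (rhs n) (sumBelow-* (suc d) c p) (homogeneous (shiftP-isLinear D) c p n) ⟩
    rhs n (c * a) (c * s)
      ≡⟨ cong₂ (λ x y → (x + y) - + 2 * (c * s)) (monomial-* top c a n) (monomial-* 0 c a n) ⟩
    (c * monomial top a n + c * monomial 0 a n) - + 2 * (c * s)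
      ≡⟨ factor c (monomial top a n) (monomial 0 a n) s ⟩
    c * rhs n a s
      ∎
    where
    open ≡-Reasoning
    a : ℤ
    a = evalAt1 d p
    s : ℤ
    s = shiftP D p n
    factor : ∀ c x y u → (c * x + c * y) - + 2 * (c * u) ≡ c * ((x + y) - + 2 * u)
    factor = solve-∀

Φ-isLinear : ∀ D d → IsLinear (Φ D d)
Φ-isLinear D d = ∘-isLinear divBySq-isLinear (phiRHS-isLinear D d)

ΦIter-isLinear : ∀ D i d → IsLinear (ΦIter D i d)
ΦIter-isLinear D zero    d =
  record { f-cong = λ p≗q → p≗q ; additive = λ _ _ _ → refl ; homogeneous = λ _ _ _ → refl }
ΦIter-isLinear D (suc i) d = ∘-isLinear (ΦIter-isLinear D i (d ℕ.+ 2 ℕ.* D ℕ.∸ 2)) (Φ-isLinear D d)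

Φ-expansion : ∀ D d p n →
  Φ D d p n ≡ evalAt1 d p * (+ (suc n ℕ.∸ (d ℕ.+ 2 ℕ.* D)) + + suc n) - + 2 * divBySq (shiftP D p) n
Φ-expansion D d p n = begin
  divBySq (subP (addP (monomial top e) (monomial 0 e)) (scaleP (+ 2) (shiftP D p))) n
    ≡⟨ subtractive divBySq-isLinear _ _ n ⟩
  divBySq (addP (monomial top e) (monomial 0 e)) n - divBySq (scaleP (+ 2) (shiftP D p)) n
    ≡⟨ cong₂ _-_ (additive divBySq-isLinear _ _ n) (homogeneous divBySq-isLinear (+ 2) _ n) ⟩
  (divBySq (monomial top e) n + divBySq (monomial 0 e) n) - + 2 * divBySq (shiftP D p) n
    ≡⟨ cong (λ x → x - + 2 * divBySq (shiftP D p) n)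
            (trans (cong₂ _+_ (divBySq-monomial top e n) (divBySq-monomial 0 e n))
                   (sym (ℤₚ.*-distribˡ-+ e _ _))) ⟩
  e * (+ (suc n ℕ.∸ top) + + suc n) - + 2 * divBySq (shiftP D p) n
    ∎
  where
  open ≡-Reasoning
  top : ℕ
  top = d ℕ.+ 2 ℕ.* D
  e : ℤ
  e = evalAt1 d p

-- Trapezoids and mirror pairs

-- trapezoid a b (suc n) is the coefficient of x^n in (1 - x^a)(1 - x^b)/(1 - x)^2.
trapezoid : ℕ → ℕ → ℕ → ℤ
trapezoid a b m = + m - + (m ℕ.∸ a) - + (m ℕ.∸ b) + + (m ℕ.∸ (a ℕ.+ b))

+∸-ramp : ∀ m n → + (m ℕ.∸ n) ≡ + (n ℕ.∸ m) + (+ m - + n)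
+∸-ramp m n with ℕₚ.≤-total n m
... | inj₁ n≤m = begin
  + (m ℕ.∸ n)                     ≡⟨ ℤₚ.⊖-≥ n≤m ⟨
  m ⊖ n                           ≡⟨ ℤₚ.[+m]-[+n]≡m⊖n m n ⟨
  + m - + n                       ≡⟨ ℤₚ.+-identityˡ (+ m - + n) ⟨
  + 0 + (+ m - + n)               ≡⟨ cong (λ k → + k + (+ m - + n)) (ℕₚ.m≤n⇒m∸n≡0 n≤m) ⟨
  + (n ℕ.∸ m) + (+ m - + n)       ∎
  where open ≡-Reasoning
... | inj₂ m≤n = begin
  + (m ℕ.∸ n)                     ≡⟨ cong +_ (ℕₚ.m≤n⇒m∸n≡0 m≤n) ⟩
  + 0                             ≡⟨ ℤₚ.+-inverseʳ (+ (n ℕ.∸ m)) ⟨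
  + (n ℕ.∸ m) - + (n ℕ.∸ m)       ≡⟨ cong (_+_ (+ (n ℕ.∸ m))) (ℤₚ.⊖-≤ m≤n) ⟨
  + (n ℕ.∸ m) + (m ⊖ n)           ≡⟨ cong (_+_ (+ (n ℕ.∸ m))) (ℤₚ.[+m]-[+n]≡m⊖n m n) ⟨
  + (n ℕ.∸ m) + (+ m - + n)       ∎
  where open ≡-Reasoning

∸-exchange : ∀ m m′ a b → m ℕ.+ m′ ≡ a ℕ.+ b → a ℕ.∸ m ≡ m′ ℕ.∸ b
∸-exchange m m′ a b h = begin
  a ℕ.∸ m                    ≡⟨ ℕₚ.[m+n]∸[m+o]≡n∸o b a m ⟨
  b ℕ.+ a ℕ.∸ (b ℕ.+ m)      ≡⟨ cong₂ ℕ._∸_ (trans (ℕₚ.+-comm b a) (sym h)) (ℕₚ.+-comm b m) ⟩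
  m ℕ.+ m′ ℕ.∸ (m ℕ.+ b)     ≡⟨ ℕₚ.[m+n]∸[m+o]≡n∸o m m′ b ⟩
  m′ ℕ.∸ b                   ∎
  where open ≡-Reasoning

trapezoid-reflect : ∀ a b m → trapezoid a b m ≡ + (a ℕ.+ b ℕ.∸ m) - + (a ℕ.∸ m) - + (b ℕ.∸ m)
trapezoid-reflect a b m
  rewrite +∸-ramp m a | +∸-ramp m b | +∸-ramp m (a ℕ.+ b) | ℤₚ.pos-+ a b
  = cancel (+ m) (+ a) (+ b) (+ (a ℕ.∸ m)) (+ (b ℕ.∸ m)) (+ (a ℕ.+ b ℕ.∸ m))
  where
  cancel : ∀ m a b x y z → m - (x + (m - a)) - (y + (m - b)) + (z + (m - (a + b))) ≡ z - x - y
  cancel = solve-∀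

trapezoid-sym : ∀ a b {m m′} → m ℕ.+ m′ ≡ a ℕ.+ b → trapezoid a b m ≡ trapezoid a b m′
trapezoid-sym a b {m} {m′} h = begin
  trapezoid a b m
    ≡⟨ trapezoid-reflect a b m ⟩
  + (a ℕ.+ b ℕ.∸ m) - + (a ℕ.∸ m) - + (b ℕ.∸ m)
    ≡⟨ cong₂ (λ x y → + x - + y - + (b ℕ.∸ m)) a+b∸m≡m′ a∸m≡m′∸b ⟩
  + m′ - + (m′ ℕ.∸ b) - + (b ℕ.∸ m)
    ≡⟨ cong (λ z → + m′ - + (m′ ℕ.∸ b) - + z) b∸m≡m′∸a ⟩
  + m′ - + (m′ ℕ.∸ b) - + (m′ ℕ.∸ a)
    ≡⟨ swap (+ m′) (+ (m′ ℕ.∸ a)) (+ (m′ ℕ.∸ b)) ⟩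
  + m′ - + (m′ ℕ.∸ a) - + (m′ ℕ.∸ b) + + 0
    ≡⟨ cong (λ z → + m′ - + (m′ ℕ.∸ a) - + (m′ ℕ.∸ b) + + z) m′∸[a+b]≡0 ⟨
  trapezoid a b m′
    ∎
  where
  open ≡-Reasoning
  a+b∸m≡m′ : a ℕ.+ b ℕ.∸ m ≡ m′
  a+b∸m≡m′ = ∸-exchange m m′ (a ℕ.+ b) 0 (trans h (sym (ℕₚ.+-identityʳ (a ℕ.+ b))))
  a∸m≡m′∸b : a ℕ.∸ m ≡ m′ ℕ.∸ b
  a∸m≡m′∸b = ∸-exchange m m′ a b h
  b∸m≡m′∸a : b ℕ.∸ m ≡ m′ ℕ.∸ a
  b∸m≡m′∸a = ∸-exchange m m′ b a (trans h (ℕₚ.+-comm a b))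
  m′∸[a+b]≡0 : m′ ℕ.∸ (a ℕ.+ b) ≡ 0
  m′∸[a+b]≡0 = trans (sym (∸-exchange m m′ 0 (a ℕ.+ b) h)) (ℕₚ.0∸n≡0 m)
  swap : ∀ x y z → x - z - y ≡ x - y - z + + 0
  swap = solve-∀

trapezoid-vanishes : ∀ a b {m} → a ℕ.+ b ≤ m → trapezoid a b m ≡ + 0
trapezoid-vanishes a b {m} a+b≤m
  rewrite trapezoid-reflect a b m
        | ℕₚ.m≤n⇒m∸n≡0 a+b≤m
        | ℕₚ.m≤n⇒m∸n≡0 (ℕₚ.≤-trans (ℕₚ.m≤m+n a b) a+b≤m)
        | ℕₚ.m≤n⇒m∸n≡0 (ℕₚ.≤-trans (ℕₚ.m≤n+m b a) a+b≤m)
  = refl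

trapezoid-0ˡ : ∀ b m → trapezoid 0 b m ≡ + 0
trapezoid-0ˡ b m = cancel (+ m) (+ (m ℕ.∸ b))
  where
  cancel : ∀ x y → x - x - y + y ≡ + 0
  cancel = solve-∀

mirrorPair : ℕ → ℕ → Poly
mirrorPair d i = addP (monomial i (+ 1)) (monomial (d ℕ.∸ i) (+ 1))

mirrorPair-≢ : ∀ d i n → n ≢ i → n ≢ d ℕ.∸ i → mirrorPair d i n ≡ + 0
mirrorPair-≢ d i n n≢i n≢d∸i = cong₂ _+_ (monomial-≢ i (+ 1) n≢i) (monomial-≢ (d ℕ.∸ i) (+ 1) n≢d∸i)

mirrorPair-exponents : ∀ D d i → i ≤ d → d ℕ.+ 2 ℕ.* D ≡ (D ℕ.+ i) ℕ.+ (D ℕ.+ (d ℕ.∸ i))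
mirrorPair-exponents D d i i≤d =
  trans (cong (ℕ._+ 2 ℕ.* D) (sym (ℕₚ.m+[n∸m]≡n i≤d))) (regroup i (d ℕ.∸ i) D)
  where
  regroup : ∀ x y z → x ℕ.+ y ℕ.+ 2 ℕ.* z ≡ (z ℕ.+ x) ℕ.+ (z ℕ.+ y)
  regroup = ℕ-Solver.solve-∀

evalAt1-mirrorPair : ∀ d i → i ≤ d → evalAt1 d (mirrorPair d i) ≡ + 2
evalAt1-mirrorPair d i i≤d =
  trans (sumBelow-+ (suc d) (monomial i (+ 1)) (monomial (d ℕ.∸ i) (+ 1)))
        (cong₂ _+_ (sumBelow-monomial (suc d) i (+ 1) (s≤s i≤d))
                   (sumBelow-monomial (suc d) (d ℕ.∸ i) (+ 1) (s≤s (ℕₚ.m∸n≤m d i))))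

shiftP-mirrorPair : ∀ D d i →
  shiftP D (mirrorPair d i) ≗ addP (monomial (D ℕ.+ i) (+ 1)) (monomial (D ℕ.+ (d ℕ.∸ i)) (+ 1))
shiftP-mirrorPair D d i k =
  trans (additive (shiftP-isLinear D) (monomial i (+ 1)) (monomial (d ℕ.∸ i) (+ 1)) k)
        (cong₂ _+_ (shiftP-monomial D i (+ 1) k) (shiftP-monomial D (d ℕ.∸ i) (+ 1) k))

Φ-mirrorPair : ∀ D d i → i ≤ d →
  Φ D d (mirrorPair d i) ≗ scaleP (+ 2) (trapezoid (D ℕ.+ i) (D ℕ.+ (d ℕ.∸ i)) ∘ suc)
Φ-mirrorPair D d i i≤d n = begin
  Φ D d (mirrorPair d i) n
    ≡⟨ Φ-expansion D d (mirrorPair d i) n ⟩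
  evalAt1 d (mirrorPair d i) * (r top + + suc n) - + 2 * divBySq (shiftP D (mirrorPair d i)) n
    ≡⟨ cong₂ (λ e x → e * (r top + + suc n) - + 2 * x) (evalAt1-mirrorPair d i i≤d) divBySq-shifted ⟩
  + 2 * (r top + + suc n) - + 2 * (r a + r b)
    ≡⟨ cong (λ t → + 2 * (r t + + suc n) - + 2 * (r a + r b)) (mirrorPair-exponents D d i i≤d) ⟩
  + 2 * (r (a ℕ.+ b) + + suc n) - + 2 * (r a + r b)
    ≡⟨ rearrange (r (a ℕ.+ b)) (+ suc n) (r a) (r b) ⟩
  + 2 * trapezoid a b (suc n)
    ∎
  where
  open ≡-Reasoning
  top : ℕ
  top = d ℕ.+ 2 ℕ.* D
  a : ℕ
  a = D ℕ.+ i
  b : ℕ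
  b = D ℕ.+ (d ℕ.∸ i)

  r : ℕ → ℤ
  r t = + (suc n ℕ.∸ t)

  divBySq-shifted : divBySq (shiftP D (mirrorPair d i)) n ≡ r a + r b
  divBySq-shifted = begin
    divBySq (shiftP D (mirrorPair d i)) n
      ≡⟨ f-cong divBySq-isLinear (shiftP-mirrorPair D d i) n ⟩
    divBySq (addP (monomial a (+ 1)) (monomial b (+ 1))) n
      ≡⟨ additive divBySq-isLinear (monomial a (+ 1)) (monomial b (+ 1)) n ⟩
    divBySq (monomial a (+ 1)) n + divBySq (monomial b (+ 1)) n
      ≡⟨ cong₂ _+_ (trans (divBySq-monomial a (+ 1) n) (ℤₚ.*-identityˡ (r a)))
                   (trans (divBySq-monomial b (+ 1) n) (ℤₚ.*-identityˡ (r b))) ⟩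
    r a + r b
      ∎

  rearrange : ∀ w x y z → + 2 * (w + x) - + 2 * (y + z) ≡ + 2 * (x - y - z + w)
  rearrange = solve-∀

-- Odd palindromic polynomials

halfΦ : ℕ → ℕ → ℕ → Poly → Poly
halfΦ D d k p n = sumBelow (suc k) (λ i → p i * trapezoid (D ℕ.+ i) (D ℕ.+ (d ℕ.∸ i)) (suc n))

module _ {d k : ℕ} (d≡ : d ≡ suc (2 ℕ.* k)) where

  private
    d≡1+k+k : d ≡ suc k ℕ.+ k
    d≡1+k+k = trans d≡ (double k)
      where
      double : ∀ k → suc (2 ℕ.* k) ≡ suc k ℕ.+ k
      double = ℕ-Solver.solve-∀

    k≤d : k ≤ d
    k≤d = subst (k ≤_) (sym d≡1+k+k) (ℕₚ.m≤n+m k (suc k))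

    <1+k⇒≤d : ∀ {i} → i < suc k → i ≤ d
    <1+k⇒≤d i<1+k = ℕₚ.≤-trans (ℕₚ.≤-pred i<1+k) k≤d

    k<d∸i : ∀ {i} → i ≤ k → k < d ℕ.∸ i
    k<d∸i i≤k = ℕₚ.≤-trans (ℕₚ.≤-reflexive (sym d∸k≡1+k)) (ℕₚ.∸-monoʳ-≤ d i≤k)
      where
      d∸k≡1+k : d ℕ.∸ k ≡ suc k
      d∸k≡1+k = trans (cong (ℕ._∸ k) d≡1+k+k) (ℕₚ.m+n∸n≡m (suc k) k)

    d∸n≤k : ∀ {n} → k < n → d ℕ.∸ n ≤ k
    d∸n≤k k<n = ℕₚ.≤-trans (ℕₚ.∸-monoʳ-≤ d k<n) (ℕₚ.≤-reflexive d∸[1+k]≡k)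
      where
      d∸[1+k]≡k : d ℕ.∸ suc k ≡ k
      d∸[1+k]≡k = trans (cong (ℕ._∸ suc k) d≡1+k+k) (ℕₚ.m+n∸m≡n (suc k) k)

  module _ (p : Poly) where

    mirrorSum : ℕ → ℤ
    mirrorSum n = sumBelow (suc k) (λ i → p i * mirrorPair d i n)

    mirrorSum-low : ∀ {n} → n ≤ k → mirrorSum n ≡ p n
    mirrorSum-low {n} n≤k = trans (sumBelow-single (suc k) n (s≤s n≤k) others) diagonal
      where
      n≢d∸n : n ≢ d ℕ.∸ n
      n≢d∸n = ℕₚ.<⇒≢ (ℕₚ.≤-<-trans n≤k (k<d∸i n≤k))

      diagonal : p n * mirrorPair d n n ≡ p n
      diagonal = trans (cong (p n *_) (cong₂ _+_ (monomial-≡ n (+ 1)) (monomial-≢ (d ℕ.∸ n) (+ 1) n≢d∸n)))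
                       (ℤₚ.*-identityʳ (p n))

      others : ∀ i → i < suc k → i ≢ n → p i * mirrorPair d i n ≡ + 0
      others i i<1+k i≢n = trans (cong (p i *_) (mirrorPair-≢ d i n (i≢n ∘ sym) n≢d∸i)) (ℤₚ.*-zeroʳ (p i))
        where
        n≢d∸i : n ≢ d ℕ.∸ i
        n≢d∸i = ℕₚ.<⇒≢ (ℕₚ.≤-<-trans n≤k (k<d∸i (ℕₚ.≤-pred i<1+k)))

    mirrorSum-high : ∀ {n} → Palindromic d p → k < n → n ≤ d → mirrorSum n ≡ p n
    mirrorSum-high {n} (mirror , _) k<n n≤d =
      trans (sumBelow-single (suc k) (d ℕ.∸ n) (s≤s (d∸n≤k k<n)) others) diagonal
      where
      n≢d∸n : n ≢ d ℕ.∸ n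
      n≢d∸n n≡d∸n = ℕₚ.<⇒≢ (ℕₚ.≤-<-trans (d∸n≤k k<n) k<n) (sym n≡d∸n)

      diagonal : p (d ℕ.∸ n) * mirrorPair d (d ℕ.∸ n) n ≡ p n
      diagonal = begin
        p (d ℕ.∸ n) * mirrorPair d (d ℕ.∸ n) n
          ≡⟨ cong (p (d ℕ.∸ n) *_) (cong₂ _+_ (monomial-≢ (d ℕ.∸ n) (+ 1) n≢d∸n)
                                              (trans (cong (λ t → monomial t (+ 1) n) (ℕₚ.m∸[m∸n]≡n n≤d))
                                                     (monomial-≡ n (+ 1)))) ⟩
        p (d ℕ.∸ n) * + 1
          ≡⟨ ℤₚ.*-identityʳ (p (d ℕ.∸ n)) ⟩
        p (d ℕ.∸ n)
          ≡⟨ mirror n n≤d ⟨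
        p n
          ∎
        where open ≡-Reasoning

      others : ∀ i → i < suc k → i ≢ d ℕ.∸ n → p i * mirrorPair d i n ≡ + 0
      others i i<1+k i≢d∸n = trans (cong (p i *_) (mirrorPair-≢ d i n n≢i n≢d∸i)) (ℤₚ.*-zeroʳ (p i))
        where
        n≢i : n ≢ i
        n≢i n≡i = ℕₚ.<⇒≢ (ℕₚ.≤-<-trans (ℕₚ.≤-pred i<1+k) k<n) (sym n≡i)
        n≢d∸i : n ≢ d ℕ.∸ i
        n≢d∸i n≡d∸i = i≢d∸n (trans (sym (ℕₚ.m∸[m∸n]≡n (<1+k⇒≤d i<1+k)))
                                   (cong (d ℕ.∸_) (sym n≡d∸i)))

    mirrorSum-beyond : ∀ {n} → d < n → mirrorSum n ≡ + 0
    mirrorSum-beyond {n} d<n = sumBelow-zero (suc k) (λ i i<1+k →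
      trans (cong (p i *_) (mirrorPair-≢ d i n (λ { refl → ℕₚ.<⇒≱ d<n (<1+k⇒≤d i<1+k) })
                                               (λ { refl → ℕₚ.<⇒≱ d<n (ℕₚ.m∸n≤m d i) })))
            (ℤₚ.*-zeroʳ (p i)))

  odd-palindromic-decomposition : ∀ {p} → Palindromic d p → p ≗ mirrorSum p
  odd-palindromic-decomposition {p} pal@(_ , beyond) n with n ℕₚ.≤? k | n ℕₚ.≤? d
  ... | yes n≤k | _      = sym (mirrorSum-low p n≤k)
  ... | no n≰k | yes n≤d = sym (mirrorSum-high p pal (ℕₚ.≰⇒> n≰k) n≤d)
  ... | no _   | no n≰d  = trans (beyond n d<n) (sym (mirrorSum-beyond p d<n))
    where d<n = ℕₚ.≰⇒> n≰d

  Φ-odd-palindromic : ∀ D {p} → Palindromic d p → Φ D d p ≗ scaleP (+ 2) (halfΦ D d k p)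
  Φ-odd-palindromic D {p} pal n = begin
    Φ D d p n
      ≡⟨ f-cong Φ-lin (odd-palindromic-decomposition pal) n ⟩
    Φ D d (λ n → sumBelow (suc k) (λ i → scaleP (p i) (mirrorPair d i) n)) n
      ≡⟨ sumBelow-commute Φ-lin (suc k) (λ i → scaleP (p i) (mirrorPair d i)) n ⟩
    sumBelow (suc k) (λ i → Φ D d (scaleP (p i) (mirrorPair d i)) n)
      ≡⟨ sumBelow-cong (suc k) Φ-term ⟩
    sumBelow (suc k) (λ i → + 2 * (p i * T i))
      ≡⟨ sumBelow-* (suc k) (+ 2) (λ i → p i * T i) ⟩
    + 2 * halfΦ D d k p n
      ∎
    where
    open ≡-Reasoning
    Φ-lin : IsLinear (Φ D d)
    Φ-lin = Φ-isLinear D d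

    T : ℕ → ℤ
    T i = trapezoid (D ℕ.+ i) (D ℕ.+ (d ℕ.∸ i)) (suc n)

    Φ-term : ∀ i → i < suc k → Φ D d (scaleP (p i) (mirrorPair d i)) n ≡ + 2 * (p i * T i)
    Φ-term i i<1+k = begin
      Φ D d (scaleP (p i) (mirrorPair d i)) n ≡⟨ homogeneous Φ-lin (p i) (mirrorPair d i) n ⟩
      p i * Φ D d (mirrorPair d i) n          ≡⟨ cong (p i *_) (Φ-mirrorPair D d i (<1+k⇒≤d i<1+k) n) ⟩
      p i * (+ 2 * T i)                       ≡⟨ *-left-swap (p i) (+ 2) (T i) ⟩
      + 2 * (p i * T i)                       ∎

  halfΦ-palindromic : ∀ D c p → d ℕ.+ 2 ℕ.* D ≡ 2 ℕ.+ c → Palindromic c (halfΦ D d k p)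
  halfΦ-palindromic D c p top≡ = mirror , beyond
    where
    exponents : ∀ i → i < suc k → (D ℕ.+ i) ℕ.+ (D ℕ.+ (d ℕ.∸ i)) ≡ 2 ℕ.+ c
    exponents i i<1+k = trans (sym (mirrorPair-exponents D d i (<1+k⇒≤d i<1+k))) top≡

    mirror : ∀ j → j ≤ c → halfΦ D d k p j ≡ halfΦ D d k p (c ℕ.∸ j)
    mirror j j≤c = sumBelow-cong (suc k) (λ i i<1+k →
      cong (p i *_) (trapezoid-sym (D ℕ.+ i) (D ℕ.+ (d ℕ.∸ i)) (trans arguments (sym (exponents i i<1+k)))))
      where
      arguments : suc j ℕ.+ suc (c ℕ.∸ j) ≡ 2 ℕ.+ c
      arguments = trans (cong suc (ℕₚ.+-suc j (c ℕ.∸ j))) (cong (ℕ._+_ 2) (ℕₚ.m+[n∸m]≡n j≤c))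

    beyond : ∀ j → c < j → halfΦ D d k p j ≡ + 0
    beyond j c<j = sumBelow-zero (suc k) (λ i i<1+k →
      trans (cong (p i *_) (trapezoid-vanishes (D ℕ.+ i) (D ℕ.+ (d ℕ.∸ i))
                                               (subst (_≤ suc j) (sym (exponents i i<1+k)) (s≤s c<j))))
            (ℤₚ.*-zeroʳ (p i)))

halfΦ-degenerate : ∀ d p → halfΦ 0 d 0 p ≗ (λ _ → + 0)
halfΦ-degenerate d p n = begin
  + 0 + p 0 * trapezoid 0 d (suc n)  ≡⟨ ℤₚ.+-identityˡ _ ⟩
  p 0 * trapezoid 0 d (suc n)        ≡⟨ cong (p 0 *_) (trapezoid-0ˡ d (suc n)) ⟩
  p 0 * + 0                          ≡⟨ ℤₚ.*-zeroʳ (p 0) ⟩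
  + 0                                ∎
  where open ≡-Reasoning

odd-shifted-index : ∀ {d} k D {m} → d ≡ suc (2 ℕ.* k) → k ℕ.+ D ≡ suc m →
                    d ℕ.+ 2 ℕ.* D ≡ 2 ℕ.+ suc (2 ℕ.* m)
odd-shifted-index {d} k D {m} d≡ k+D≡ =
  trans (cong (ℕ._+ 2 ℕ.* D) d≡)
        (trans (regroup k D) (trans (cong (λ x → suc (2 ℕ.* x)) k+D≡) (unfold m)))
  where
  regroup : ∀ k D → suc (2 ℕ.* k) ℕ.+ 2 ℕ.* D ≡ suc (2 ℕ.* (k ℕ.+ D))
  regroup = ℕ-Solver.solve-∀
  unfold : ∀ m → suc (2 ℕ.* suc m) ≡ 2 ℕ.+ suc (2 ℕ.* m)
  unfold = ℕ-Solver.solve-∀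

data OddPalindromicOrZero (d : ℕ) (p : Poly) : Set where
  odd-palindromic : OddNat d → Palindromic d p → OddPalindromicOrZero d p
  zero-poly       : p ≗ (λ _ → + 0) → OddPalindromicOrZero d p

Φ-halves : ∀ D {d p} → OddPalindromicOrZero d p →
           Σ Poly λ q → Φ D d p ≗ scaleP (+ 2) q × OddPalindromicOrZero (d ℕ.+ 2 ℕ.* D ℕ.∸ 2) q
Φ-halves D {d} (zero-poly p≗0) =
  (λ _ → + 0) , zero-preserving (Φ-isLinear D d) p≗0 , zero-poly (λ _ → refl)
Φ-halves D {d} {p} (odd-palindromic (k , d≡) pal) =
  halfΦ D d k p , Φ-odd-palindromic {k = k} d≡ D pal , next
  where
  next : OddPalindromicOrZero (d ℕ.+ 2 ℕ.* D ℕ.∸ 2) (halfΦ D d k p)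
  next with k ℕ.+ D in k+D≡
  ... | suc m = subst (λ e → OddPalindromicOrZero (e ℕ.∸ 2) (halfΦ D d k p)) (sym top≡)
                      (odd-palindromic (m , refl) (halfΦ-palindromic {k = k} d≡ D _ p top≡))
    where
    top≡ : d ℕ.+ 2 ℕ.* D ≡ 2 ℕ.+ suc (2 ℕ.* m)
    top≡ = odd-shifted-index k D d≡ k+D≡
  ... | zero  = zero-poly (λ n → subst₂ (λ D k → halfΦ D d k p n ≡ + 0)
                                        (sym (ℕₚ.m+n≡0⇒n≡0 k k+D≡)) (sym (ℕₚ.m+n≡0⇒m≡0 k k+D≡))
                                        (halfΦ-degenerate d p n))

ΦIter-divisible : ∀ D i {d p} → OddPalindromicOrZero d p → ∀ n → + (2 ^ i) ∣ ΦIter D i d p n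
ΦIter-divisible D zero    _ n = 1∣ _
ΦIter-divisible D (suc i) {d} {p} inv n with Φ-halves D inv
... | q , Φp≗2q , inv′ = subst (+ (2 ^ suc i) ∣_) (sym doubled) twice-divisible
  where
  d′ : ℕ
  d′ = d ℕ.+ 2 ℕ.* D ℕ.∸ 2

  doubled : ΦIter D (suc i) d p n ≡ + 2 * ΦIter D i d′ q n
  doubled = trans (f-cong (ΦIter-isLinear D i d′) Φp≗2q n)
                  (homogeneous (ΦIter-isLinear D i d′) (+ 2) q n)

  twice-divisible : + (2 ^ suc i) ∣ + 2 * ΦIter D i d′ q n
  twice-divisible = subst (_∣ + 2 * ΦIter D i d′ q n) (sym (ℤₚ.pos-* 2 (2 ^ i)))
                          (*-monoʳ-∣ (+ 2) {+ (2 ^ i)} {ΦIter D i d′ q n} (ΦIter-divisible D i inv′ n))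

lemma4 : (D d : ℕ) (p : Poly) → OddNat d → Palindromic d p →
    (i n : ℕ) → (+ (2 ^ i)) ∣ ΦIter D i d p n
lemma4 D d p odd pal i n = ΦIter-divisible D i (odd-palindromic odd pal) n
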